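{- Let $w\in\{0,1\}^n$ be an unbordered word in which neither $0$ nor $1$ occurs exactly once. Suppose $w$ is palindromically generated by a set $S\subseteq\mathcal{S}(n)$ with $\#S\le 3$. Then $S$ has at most two leaves with label $0$ and at most two leaves with label $1$.
   Context: For $w=w_1\cdots w_n$, $w[i]=w_i$ and $w[i,j]=w_i\cdots w_j$; $\mathcal{S}(n)=\{(i,j)\mid 1\le i\le j\le n\}$; $\mathrm{alph}(w)$ is the set of letters of $w$. A set $S\subseteq\mathcal{S}(n)$ palindromically generates $w$ if (1) $w[i,j]$ is a palindrome for all $(i,j)\in S$, and (2) for every nonempty set $\mathbb{B}$ and every $v\in\mathbb{B}^n$ with $v[i,j]$ a palindrome for all $(i,j)\in S$, there is a map $c\colon\mathrm{alph}(w)\to\mathbb{B}$ whose extension to a morphism satisfies $c(w)=v$. For $I=(i,j)$, $\rho_I(k)=i+j-k$ for $i\le k\le j$. If $S$ palindromically generates $w$, a position $m\in\{1,\dots,n\}$ is a leaf of $S$ with label $w[m]$ if there is at most one pair $I=(i,j)\in S$ with $i\le m\le j$ and $\rho_I(m)\ne m$. A word is unbordered if no nonempty word is both a proper prefix and a proper suffix of it. -}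

module Defs where

open import Data.Bool using (Bool; true; false)
open import Data.Nat using (ℕ; zero; suc; _+_; _∸_; _≤_; _<_)
open import Data.List using (List; []; _∷_; _++_; length; map)
open import Data.List.Relation.Unary.All using (All)
open import Data.List.Membership.Propositional using (_∈_)
open import Data.Maybe using (Maybe; just; nothing)
open import Data.Product using (_×_; _,_; ∃)
open import Relation.Binary.PropositionalEquality using (_≡_; _≢_)
open import Relation.Nullary using (¬_; yes; no)
open import Data.Empty using (⊥)

-- Words are lists; positions are 1-indexed: at w k = just w[k] for 1 ≤ k ≤ |w|,
-- nothing otherwise.
at : {A : Set} → List A → ℕ → Maybe A
at []       _             = nothing
at (x ∷ xs) zero          = nothing
at (x ∷ xs) (suc zero)    = just x
at (x ∷ xs) (suc (suc k)) = at xs (suc k)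

occ : Bool → List Bool → ℕ
occ a []       = 0
occ a (b ∷ bs) with a Data.Bool.≟ b
... | yes _ = suc (occ a bs)
... | no  _ = occ a bs

Unbordered : {A : Set} → List A → Set
Unbordered {A} w = ∀ (u : List A) → u ≢ [] → length u < length w →
  (∃ λ t → u ++ t ≡ w) → (∃ λ t → t ++ u ≡ w) → ⊥

InS : ℕ → ℕ × ℕ → Set
InS n (i , j) = 1 ≤ i × i ≤ j × j ≤ n

PalFactor : {A : Set} → List A → ℕ × ℕ → Set
PalFactor w (i , j) = ∀ k → i ≤ k → k ≤ j → at w k ≡ at w (i + j ∸ k)

PalGen : List (ℕ × ℕ) → List Bool → Set₁
PalGen S w =
  All (PalFactor w) S ×
  (∀ (𝔹 : Set) → 𝔹 →
     ∀ (v : List 𝔹) → length v ≡ length w → All (PalFactor v) S →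
     ∃ λ (c : Bool → 𝔹) → map c w ≡ v)

Active : ℕ → ℕ × ℕ → Set
Active m (i , j) = i ≤ m × m ≤ j × (i + j ∸ m ≢ m)

IsLeaf : ℕ → List (ℕ × ℕ) → ℕ → Set
IsLeaf n S m = 1 ≤ m × m ≤ n ×
  (∀ I J → I ∈ S → J ∈ S → Active m I → Active m J → I ≡ J)

-- Join k and ρ_I(k) whenever I ∈ S is active at k. The component of a leaf m₁ in this graph is
-- closed under every reflection of S, so by palindromic generation it contains every position
-- carrying the letter of m₁. Every position is active in some interval (else its letter would occur
-- exactly once); hence the intervals active at 1 and at n are a palindromic prefix and a palindromic
-- suffix, which cannot overlap in an unbordered word. With #S ≤ 3 a vertex with three neighbours
-- would lie in every interval of S, in particular in both of them; so all degrees are at most two,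
-- the component of m₁ is a path starting at m₁, and a second leaf can only be its other end.
module Submission where

open import Defs
open import Data.Bool using (Bool; true; false)
open import Data.Nat using (ℕ; zero; suc; _+_; _∸_; _≤_; _<_; z≤n; s≤s; _≤?_; _<?_; s≤s⁻¹)
open import Data.Nat.Properties
open import Data.Nat.Tactic.RingSolver using (solve-∀)
open import Data.List using (List; []; _∷_; _++_; length; map; take; drop; applyUpTo)
open import Data.List.Properties using (length-take; length-drop; take++drop≡id; length-applyUpTo; length-removeAt′)
open import Data.List.Relation.Unary.All using (All; _∷_; [])
import Data.List.Relation.Unary.All as All
open import Data.List.Relation.Unary.AllPairs using (_∷_; [])
open import Data.List.Relation.Unary.Any using (Any; here; there; any?; index)
import Data.List.Relation.Unary.Any as Any
open import Data.List.Relation.Unary.Unique.Propositional using (Unique)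
open import Data.List.Membership.Propositional using (_∈_; _─_; find; lose)
open import Data.List.Relation.Binary.Subset.Propositional using (_⊆_)
open import Data.Maybe using (just)
open import Data.Maybe.Properties using (just-injective)
import Data.Maybe as Maybe
open import Data.Product using (_×_; _,_; proj₁; proj₂; ∃)
import Data.Product as Product
open import Data.Product.Properties using (≡-dec)
open import Data.Sum using (_⊎_; inj₁; inj₂; [_,_])
open import Data.Empty using (⊥; ⊥-elim)
open import Function using (_∘_; id; mk⇔)
open import Relation.Binary using (DecidableEquality; tri<; tri≈; tri>)
open import Relation.Binary.PropositionalEquality
  using (_≡_; _≢_; refl; sym; trans; cong; subst; subst₂; module ≡-Reasoning)
open import Relation.Nullary using (¬_; Dec; yes; no; does; _×-dec_; _⊎-dec_; ¬?)
open import Relation.Nullary.Decidable using (does-⇔; dec-true)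
open import Relation.Unary using (Decidable)

at-there : ∀ {A : Set} (x : A) xs k {a} → at xs k ≡ just a → at (x ∷ xs) (suc k) ≡ just a
at-there x (_ ∷ _) (suc k) xs[k]≡a = xs[k]≡a

at-just⇒inRange : ∀ {A : Set} (xs : List A) k {a} → at xs k ≡ just a → 1 ≤ k × k ≤ length xs
at-just⇒inRange (x ∷ xs) (suc zero) _ = s≤s z≤n , s≤s z≤n
at-just⇒inRange (x ∷ xs) (suc (suc k)) e = s≤s z≤n , s≤s (proj₂ (at-just⇒inRange xs (suc k) e))

at-inRange⇒just : ∀ {A : Set} (xs : List A) k → 1 ≤ k → k ≤ length xs → ∃ λ a → at xs k ≡ just a
at-inRange⇒just (x ∷ xs) (suc zero) _ _ = x , refl
at-inRange⇒just (x ∷ xs) (suc (suc k)) _ (s≤s k≤n) = at-inRange⇒just xs (suc k) (s≤s z≤n) k≤n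

at-map : ∀ {A B : Set} (f : A → B) (xs : List A) k → at (map f xs) k ≡ Maybe.map f (at xs k)
at-map f [] k = refl
at-map f (x ∷ xs) zero = refl
at-map f (x ∷ xs) (suc zero) = refl
at-map f (x ∷ xs) (suc (suc k)) = at-map f xs (suc k)

at-applyUpTo : ∀ {A : Set} (f : ℕ → A) n k → k < n → at (applyUpTo f n) (suc k) ≡ just (f k)
at-applyUpTo f (suc n) zero _ = refl
at-applyUpTo f (suc n) (suc k) (s≤s k<n) = at-applyUpTo (f ∘ suc) n k k<n

at-take : ∀ {A : Set} (xs : List A) o k → k < o → at (take o xs) (suc k) ≡ at xs (suc k)
at-take [] (suc o) k _ = refl
at-take (x ∷ xs) (suc o) zero _ = refl
at-take (x ∷ xs) (suc o) (suc k) (s≤s k<o) = at-take xs o k k<o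

at-drop : ∀ {A : Set} (xs : List A) t k → at (drop t xs) (suc k) ≡ at xs (suc (t + k))
at-drop xs zero k = refl
at-drop [] (suc t) k = refl
at-drop (x ∷ xs) (suc t) k = at-drop xs t k

at-ext : ∀ {A : Set} (xs ys : List A) → length xs ≡ length ys →
  (∀ k → 1 ≤ k → k ≤ length xs → at xs k ≡ at ys k) → xs ≡ ys
at-ext [] [] _ _ = refl
at-ext (x ∷ xs) (y ∷ ys) |xs|≡|ys| same with same 1 (s≤s z≤n) (s≤s z≤n)
... | refl = cong (x ∷_) (at-ext xs ys (suc-injective |xs|≡|ys|) tail-same)
  where
  tail-same : ∀ k → 1 ≤ k → k ≤ length xs → at xs k ≡ at ys k
  tail-same (suc k) _ k≤n = same (suc (suc k)) (s≤s z≤n) (s≤s k≤n)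

occ-≡0 : ∀ a w → (∀ k → at w k ≢ just a) → occ a w ≡ 0
occ-≡0 a [] _ = refl
occ-≡0 a (b ∷ w) absent with a Data.Bool.≟ b
... | yes refl = ⊥-elim (absent 1 refl)
... | no _ = occ-≡0 a w (λ k → absent (suc k) ∘ at-there b w k)

occ-≡1 : ∀ a w m → at w m ≡ just a → (∀ k → at w k ≡ just a → k ≡ m) → occ a w ≡ 1
occ-≡1 a (b ∷ w) m _ only-m with a Data.Bool.≟ b
occ-≡1 a (b ∷ w) m _ only-m | yes refl = cong suc (occ-≡0 a w not-later)
  where
  not-later : ∀ k → at w k ≢ just a
  not-later k wk with trans (only-m (suc k) (at-there b w k wk)) (sym (only-m 1 refl))
  ... | refl = <-irrefl refl (proj₁ (at-just⇒inRange w k wk))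
occ-≡1 a (b ∷ w) (suc zero) refl _ | no a≢a = ⊥-elim (a≢a refl)
occ-≡1 a (b ∷ w) (suc (suc m)) wm only-m | no _ =
  occ-≡1 a w (suc m) wm (λ k wk → suc-injective (only-m (suc k) (at-there b w k wk)))

HasPeriod : {A : Set} → List A → ℕ → Set
HasPeriod w t = ∀ k → 1 ≤ k → t + k ≤ length w → at w k ≡ at w (t + k)

unbordered⇒¬period : ∀ {A : Set} (w : List A) {t} → Unbordered w → 1 ≤ t → t < length w →
  ¬ HasPeriod w t
unbordered⇒¬period w {t} unbordered 1≤t t<n period with m≤n⇒∃[o]m+o≡n t<n
... | o-1 , 1+t+o-1≡n =
  unbordered (take o w) u≢[] |u|<n (drop o w , take++drop≡id o w) (take t w , u-suffix)
  where
  n : ℕ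
  n = length w
  o : ℕ
  o = suc o-1
  t+o≡n : t + o ≡ n
  t+o≡n = trans (+-suc t o-1) 1+t+o-1≡n
  |u|≡o : length (take o w) ≡ o
  |u|≡o = trans (length-take o w) (m≤n⇒m⊓n≡m (subst (o ≤_) t+o≡n (m≤n+m o t)))
  u≢[] : take o w ≢ []
  u≢[] u≡[] = 1+n≢0 (trans (sym |u|≡o) (cong length u≡[]))
  |u|<n : length (take o w) < n
  |u|<n = subst₂ _<_ (sym |u|≡o) t+o≡n (m<n+m o 1≤t)
  |drop|≡o : length (drop t w) ≡ o
  |drop|≡o = trans (length-drop t w) (trans (cong (_∸ t) (sym t+o≡n)) (m+n∸m≡n t o))
  drop≡u : drop t w ≡ take o w
  drop≡u = at-ext (drop t w) (take o w) (trans |drop|≡o (sym |u|≡o)) same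
    where
    same : ∀ k → 1 ≤ k → k ≤ length (drop t w) → at (drop t w) k ≡ at (take o w) k
    same (suc k) _ k<|drop| = begin
      at (drop t w) (suc k)  ≡⟨ at-drop w t k ⟩
      at w (suc (t + k))     ≡⟨ cong (at w) (sym (+-suc t k)) ⟩
      at w (t + suc k)       ≡⟨ sym (period (suc k) (s≤s z≤n) t+k+1≤n) ⟩
      at w (suc k)           ≡⟨ sym (at-take w o k k<o) ⟩
      at (take o w) (suc k)  ∎
      where
      open ≡-Reasoning
      k<o : k < o
      k<o = subst (suc k ≤_) |drop|≡o k<|drop|
      t+k+1≤n : t + suc k ≤ n
      t+k+1≤n = subst (t + suc k ≤_) t+o≡n (+-monoʳ-≤ t k<o)
  u-suffix : take t w ++ take o w ≡ w
  u-suffix = trans (cong (take t w ++_) (sym drop≡u)) (take++drop≡id t w)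

palindrome-mirror : ∀ {A : Set} (w : List A) {i j} a b → PalFactor w (i , j) → i + (a + b) ≡ j →
  at w (i + a) ≡ at w (i + b)
palindrome-mirror w {i} a b palindrome refl =
  trans (palindrome (i + a) (m≤m+n i a) (+-monoʳ-≤ i (m≤m+n a b))) (cong (at w) mirrored)
  where
  shuffle : ∀ i a b → i + (a + b) ≡ a + (i + b)
  shuffle = solve-∀
  mirrored : i + (i + (a + b)) ∸ (i + a) ≡ i + b
  mirrored = begin
    i + (i + (a + b)) ∸ (i + a)  ≡⟨ [m+n]∸[m+o]≡n∸o i (i + (a + b)) a ⟩
    i + (a + b) ∸ a              ≡⟨ cong (_∸ a) (shuffle i a b) ⟩
    a + (i + b) ∸ a              ≡⟨ m+n∸m≡n a (i + b) ⟩
    i + b                        ∎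
    where open ≡-Reasoning

palindrome-period : ∀ {A : Set} (w : List A) {m} → suc m ≡ length w → PalFactor w (1 , suc m) →
  HasPeriod w m
palindrome-period w {m} _ palindrome (suc zero) _ _ =
  trans (palindrome-mirror w 0 m palindrome refl) (cong (at w) (+-comm 1 m))
palindrome-period w {m} 1+m≡n _ (suc (suc k)) _ m+k+2≤n =
  ⊥-elim (m+1+n≰m m (s≤s⁻¹ (subst₂ _≤_ (+-suc m (suc k)) (sym 1+m≡n) m+k+2≤n)))

-- w[k] = w[p + 1 - k] = w[n + q - p - 1 + k]: reflect through the prefix, then through the suffix.
overlapping-palindromes-period : ∀ {A : Set} (w : List A) {q d e} → 1 ≤ q → suc (q + d) + e ≡ length w →
  PalFactor w (1 , q + d) → PalFactor w (q , length w) → HasPeriod w (q + e)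
overlapping-palindromes-period w {suc q-1} {d} {e} _ 1+p+e≡n prefix suffix (suc k) _ t+k+1≤n = begin
  at w (suc k)           ≡⟨ palindrome-mirror w k (q-1 + f) prefix first-reflection ⟩
  at w (q + f)           ≡⟨ palindrome-mirror w f (e + suc k) suffix second-reflection ⟩
  at w (q + (e + suc k)) ≡⟨ cong (at w) (sym (+-assoc q e (suc k))) ⟩
  at w (q + e + suc k)   ∎
  where
  open ≡-Reasoning
  q : ℕ
  q = suc q-1
  rearrange : ∀ q d e → suc (q + d) + e ≡ (q + e) + suc d
  rearrange = solve-∀
  k≤d : k ≤ d
  k≤d = s≤s⁻¹ (+-cancelˡ-≤ (q + e) (suc k) (suc d)
          (subst (q + e + suc k ≤_) (trans (sym 1+p+e≡n) (rearrange q d e)) t+k+1≤n))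
  f : ℕ
  f = proj₁ (m≤n⇒∃[o]m+o≡n k≤d)
  k+f≡d : k + f ≡ d
  k+f≡d = proj₂ (m≤n⇒∃[o]m+o≡n k≤d)
  swap : ∀ q k f → k + (q + f) ≡ q + (k + f)
  swap = solve-∀
  first-reflection : 1 + (k + (q-1 + f)) ≡ q + d
  first-reflection = cong suc (trans (swap q-1 k f) (cong (q-1 +_) k+f≡d))
  unfold : ∀ q k f e → q + (f + (e + suc k)) ≡ suc (q + (k + f)) + e
  unfold = solve-∀
  second-reflection : q + (f + (e + suc k)) ≡ length w
  second-reflection = trans (unfold q k f e) (trans (cong (λ d → suc (q + d) + e) k+f≡d) 1+p+e≡n)

palindromic-prefix-suffix-disjoint : ∀ {A : Set} (w : List A) {p q} → Unbordered w →
  1 < p → p ≤ length w → 1 ≤ q → PalFactor w (1 , p) → PalFactor w (q , length w) → p < q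
palindromic-prefix-suffix-disjoint w {suc p-1} {q} unbordered (s≤s 1≤p-1) p≤n 1≤q prefix suffix
  with suc p-1 <? q
... | yes p<q = p<q
... | no p≮q with m≤n⇒m<n∨m≡n p≤n
...   | inj₂ p≡n =
  ⊥-elim (unbordered⇒¬period w unbordered 1≤p-1 (subst (p-1 <_) p≡n ≤-refl)
           (palindrome-period w p≡n prefix))
...   | inj₁ p<n =
  ⊥-elim (unbordered⇒¬period w unbordered (≤-trans 1≤q (m≤m+n q e)) t<n
           (overlapping-palindromes-period w 1≤q 1+q+d+e≡n prefix′ suffix))
  where
  d : ℕ
  d = proj₁ (m≤n⇒∃[o]m+o≡n (≮⇒≥ p≮q))
  q+d≡p : q + d ≡ suc p-1
  q+d≡p = proj₂ (m≤n⇒∃[o]m+o≡n (≮⇒≥ p≮q))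
  e : ℕ
  e = proj₁ (m≤n⇒∃[o]m+o≡n p<n)
  1+q+d+e≡n : suc (q + d) + e ≡ length w
  1+q+d+e≡n = trans (cong (λ p → suc p + e) q+d≡p) (proj₂ (m≤n⇒∃[o]m+o≡n p<n))
  prefix′ : PalFactor w (1 , q + d)
  prefix′ = subst (λ p → PalFactor w (1 , p)) (sym q+d≡p) prefix
  t<n : q + e < length w
  t<n = subst (q + e <_) 1+q+d+e≡n (s≤s (+-monoˡ-≤ e (m≤m+n q d)))

∈-─ : ∀ {A : Set} {x y : A} {ys} (x∈ys : x ∈ ys) → y ∈ ys → x ≢ y → y ∈ ys ─ x∈ys
∈-─ (here refl) (here refl) x≢x = ⊥-elim (x≢x refl)
∈-─ (here refl) (there y∈ys) _ = y∈ys
∈-─ (there _) (here refl) _ = here refl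
∈-─ (there x∈ys) (there y∈ys) x≢y = there (∈-─ x∈ys y∈ys x≢y)

unique-⊆⇒length≤ : ∀ {A : Set} {xs ys : List A} → Unique xs → xs ⊆ ys → length xs ≤ length ys
unique-⊆⇒length≤ [] _ = z≤n
unique-⊆⇒length≤ {xs = x ∷ xs} {ys} (x∉xs ∷ unique) x∷xs⊆ys =
  subst (suc (length xs) ≤_) (sym (length-removeAt′ ys (index x∈ys)))
    (s≤s (unique-⊆⇒length≤ unique λ y∈xs → ∈-─ x∈ys (x∷xs⊆ys (there y∈xs)) (All.lookup x∉xs y∈xs)))
  where
  x∈ys : x ∈ ys
  x∈ys = x∷xs⊆ys (here refl)

unique-⊆-length≤⇒⊇ : ∀ {A : Set} → DecidableEquality A → ∀ {xs ys : List A} →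
  Unique xs → xs ⊆ ys → length ys ≤ length xs → ys ⊆ xs
unique-⊆-length≤⇒⊇ _≟_ {xs} {ys} unique xs⊆ys |ys|≤|xs| {y} y∈ys with any? (y ≟_) xs
... | yes y∈xs = y∈xs
... | no y∉xs = ⊥-elim (<-irrefl refl (≤-trans (unique-⊆⇒length≤ (y∉xs′ ∷ unique) y∷xs⊆ys) |ys|≤|xs|))
  where
  y∉xs′ : All (y ≢_) xs
  y∉xs′ = All.tabulate λ z∈xs y≡z → y∉xs (subst (_∈ xs) (sym y≡z) z∈xs)
  y∷xs⊆ys : y ∷ xs ⊆ ys
  y∷xs⊆ys (here refl) = y∈ys
  y∷xs⊆ys (there z∈xs) = xs⊆ys z∈xs

count : ∀ {Q : ℕ → Set} → Decidable Q → ℕ → ℕ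
count Q? zero = 0
count Q? (suc m) with Q? (suc m)
... | yes _ = suc (count Q? m)
... | no _ = count Q? m

count≤ : ∀ {Q : ℕ → Set} (Q? : Decidable Q) m → count Q? m ≤ m
count≤ Q? zero = z≤n
count≤ Q? (suc m) with Q? (suc m)
... | yes _ = s≤s (count≤ Q? m)
... | no _ = m≤n⇒m≤1+n (count≤ Q? m)

module _ {Q Q′ : ℕ → Set} (Q? : Decidable Q) (Q′? : Decidable Q′) (Q⊆Q′ : ∀ {k} → Q k → Q′ k) where

  count-mono : ∀ m → count Q? m ≤ count Q′? m
  count-mono zero = z≤n
  count-mono (suc m) with Q? (suc m) | Q′? (suc m)
  ... | yes _ | yes _ = s≤s (count-mono m)
  ... | yes q | no ¬q′ = ⊥-elim (¬q′ (Q⊆Q′ q))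
  ... | no _ | yes _ = m≤n⇒m≤1+n (count-mono m)
  ... | no _ | no _ = count-mono m

  count-mono-< : ∀ m {k} → 1 ≤ k → k ≤ m → Q′ k → ¬ Q k → count Q? m < count Q′? m
  count-mono-< zero (s≤s _) ()
  count-mono-< (suc m) {k} 1≤k k≤1+m q′ ¬q with m≤n⇒m<n∨m≡n k≤1+m | Q? (suc m) | Q′? (suc m)
  ... | _ | yes q | no ¬q′ = ⊥-elim (¬q′ (Q⊆Q′ q))
  ... | inj₂ refl | yes q | _ = ⊥-elim (¬q q)
  ... | inj₂ refl | no _ | no ¬q′ = ⊥-elim (¬q′ q′)
  ... | inj₂ refl | no _ | yes _ = s≤s (count-mono m)
  ... | inj₁ (s≤s k≤m) | yes _ | yes _ = s≤s (count-mono-< m 1≤k k≤m q′ ¬q)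
  ... | inj₁ (s≤s k≤m) | no _ | yes _ = m<n⇒m<1+n (count-mono-< m 1≤k k≤m q′ ¬q)
  ... | inj₁ (s≤s k≤m) | no _ | no _ = count-mono-< m 1≤k k≤m q′ ¬q

-- Until the sequence stops growing, its number of elements in [1, n] increases at every step.
stabilises : ∀ {P : ℕ → ℕ → Set} (P? : ∀ t → Decidable (P t)) n →
  (∀ {t k} → P t k → P (suc t) k) → (∀ {t k} → P (suc t) k → ¬ P t k → 1 ≤ k × k ≤ n) →
  ∃ λ t → ∀ {k} → P (suc t) k → P t k
stabilises {P} P? n increasing new-in-range =
  [ id , (λ n<count → ⊥-elim (≤⇒≯ (count≤ (P? (suc n)) n) n<count)) ] (grows (suc n))
  where
  Stable : ℕ → Set
  Stable t = ∀ {k} → P (suc t) k → P t k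
  grows : ∀ t → (∃ Stable) ⊎ t ≤ count (P? t) n
  grows zero = inj₂ z≤n
  grows (suc t) with grows t
  ... | inj₁ stable = inj₁ stable
  ... | inj₂ t≤count with count (P? (suc t)) n ≤? count (P? t) n
  ...   | no grew = inj₂ (≤-<-trans t≤count (≰⇒> grew))
  ...   | yes no-growth = inj₁ (t , stable)
    where
    stable : Stable t
    stable {k} new with P? t k
    ... | yes old = old
    ... | no ¬old with new-in-range new ¬old
    ...   | 1≤k , k≤n =
      ⊥-elim (≤⇒≯ no-growth (count-mono-< (P? t) (P? (suc t)) increasing n 1≤k k≤n new ¬old))

reflect : ℕ × ℕ → ℕ → ℕ
reflect (i , j) k = i + j ∸ k

_∈ᵢ_ : ℕ → ℕ × ℕ → Set
k ∈ᵢ (i , j) = i ≤ k × k ≤ j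

_∈ᵢ?_ : ∀ k I → Dec (k ∈ᵢ I)
k ∈ᵢ? (i , j) = (i ≤? k) ×-dec (k ≤? j)

reflect-∈ᵢ : ∀ I {k} → k ∈ᵢ I → reflect I k ∈ᵢ I
reflect-∈ᵢ (i , j) {k} (i≤k , k≤j) =
  subst (i ≤_) (sym (+-∸-assoc i k≤j)) (m≤m+n i (j ∸ k)) ,
  subst (_≤ j) (sym (+-∸-assoc i k≤j)) (subst (i + (j ∸ k) ≤_) (m+[n∸m]≡n k≤j) (+-monoˡ-≤ (j ∸ k) i≤k))

reflect-involutive : ∀ I {k} → k ∈ᵢ I → reflect I (reflect I k) ≡ k
reflect-involutive (i , j) {k} (_ , k≤j) = m∸[m∸n]≡n (≤-trans k≤j (m≤n+m j i))

Active⇒∈ᵢ : ∀ {k} I → Active k I → k ∈ᵢ I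
Active⇒∈ᵢ (i , j) (i≤k , k≤j , _) = i≤k , k≤j

∈ᵢ⇒Active : ∀ {k} I → k ∈ᵢ I → reflect I k ≢ k → Active k I
∈ᵢ⇒Active (i , j) (i≤k , k≤j) ρk≢k = i≤k , k≤j , ρk≢k

active? : ∀ m I → Dec (Active m I)
active? m (i , j) = (i ≤? m) ×-dec ((m ≤? j) ×-dec ¬? (i + j ∸ m ≟ m))

InvariantUnder : {B : Set} → List (ℕ × ℕ) → (ℕ → B) → Set
InvariantUnder S f = ∀ {I k} → I ∈ S → k ∈ᵢ I → f (reflect I k) ≡ f k

ClosedUnder : List (ℕ × ℕ) → (ℕ → Set) → Set
ClosedUnder S Q = ∀ {I k} → I ∈ S → k ∈ᵢ I → Q k → Q (reflect I k)

module Generation {w : List Bool} {S : List (ℕ × ℕ)}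
  (generates : PalGen S w) (inS : All (InS (length w)) S) where

  n : ℕ
  n = length w

  -- f is read off the word v = f(1) ⋯ f(n), which satisfies every palindrome constraint of S,
  -- and hence is the image of w under a letter-to-letter map.
  invariant-respects-letters : {B : Set} (f : ℕ → B) → InvariantUnder S f →
    ∀ {m m′ a} → at w m ≡ just a → at w m′ ≡ just a → f m ≡ f m′
  invariant-respects-letters {B} f invariant {m} {m′} wm wm′ = trans (letter-image wm) (sym (letter-image wm′))
    where
    v : List B
    v = applyUpTo (f ∘ suc) n
    at-v : ∀ {k} → 1 ≤ k → k ≤ n → at v k ≡ just (f k)
    at-v {suc k} _ k<n = at-applyUpTo (f ∘ suc) n k k<n
    v-palindromic : ∀ {I} → I ∈ S → PalFactor v I
    v-palindromic {i , j} I∈S k i≤k k≤j with All.lookup inS I∈S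
    ... | 1≤i , _ , j≤n =
      let ρk∈I = reflect-∈ᵢ (i , j) (i≤k , k≤j) in
      trans (at-v (≤-trans 1≤i i≤k) (≤-trans k≤j j≤n))
        (trans (cong just (sym (invariant I∈S (i≤k , k≤j))))
          (sym (at-v (≤-trans 1≤i (proj₁ ρk∈I)) (≤-trans (proj₂ ρk∈I) j≤n))))
    image : ∃ λ (c : Bool → B) → map c w ≡ v
    image = proj₂ generates B (f 0) v (length-applyUpTo (f ∘ suc) n) (All.tabulate v-palindromic)
    c : Bool → B
    c = proj₁ image
    letter-image : ∀ {k a} → at w k ≡ just a → f k ≡ c a
    letter-image {k} {a} wk with at-just⇒inRange w k wk
    ... | 1≤k , k≤n = just-injective (begin
      just (f k)                 ≡⟨ sym (at-v 1≤k k≤n) ⟩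
      at v k                     ≡⟨ cong (λ u → at u k) (sym (proj₂ image)) ⟩
      at (map c w) k             ≡⟨ at-map c w k ⟩
      Maybe.map c (at w k)       ≡⟨ cong (Maybe.map c) wk ⟩
      just (c a)                 ∎)
      where open ≡-Reasoning

  closed-respects-letters : ∀ {Q : ℕ → Set} → Decidable Q → ClosedUnder S Q →
    ∀ {m m′ a} → at w m ≡ just a → at w m′ ≡ just a → Q m → Q m′
  closed-respects-letters {Q} Q? closed wm wm′ =
    transfer (Q? _) (Q? _) (invariant-respects-letters (does ∘ Q?) invariant wm wm′)
    where
    invariant : InvariantUnder S (does ∘ Q?)
    invariant {I} {k} I∈S k∈I = does-⇔ (mk⇔ back (closed I∈S k∈I)) (Q? (reflect I k)) (Q? k)
      where
      back : Q (reflect I k) → Q k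
      back = subst Q (reflect-involutive I k∈I) ∘ closed I∈S (reflect-∈ᵢ I k∈I)
    transfer : ∀ {A B : Set} (a? : Dec A) (b? : Dec B) → does a? ≡ does b? → A → B
    transfer a? (yes b) _ _ = b
    transfer a? (no _) same a with trans (sym (dec-true a? a)) same
    ... | ()

  every-position-active : occ false w ≢ 1 → occ true w ≢ 1 → ∀ {m} → 1 ≤ m → m ≤ n → Any (Active m) S
  every-position-active occ₀≢1 occ₁≢1 {m} 1≤m m≤n with any? (active? m) S
  ... | yes active = active
  ... | no inactive = ⊥-elim (occ-≢1 a (occ-≡1 a w m wm only-m))
    where
    fixed : ∀ {I} → I ∈ S → m ∈ᵢ I → reflect I m ≡ m
    fixed {i , j} I∈S (i≤m , m≤j) with i + j ∸ m ≟ m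
    ... | yes ρm≡m = ρm≡m
    ... | no ρm≢m = ⊥-elim (inactive (lose I∈S (i≤m , m≤j , ρm≢m)))
    closed : ClosedUnder S (_≡ m)
    closed I∈S k∈I refl = fixed I∈S k∈I
    a : Bool
    a = proj₁ (at-inRange⇒just w m 1≤m m≤n)
    wm : at w m ≡ just a
    wm = proj₂ (at-inRange⇒just w m 1≤m m≤n)
    only-m : ∀ k → at w k ≡ just a → k ≡ m
    only-m k wk = closed-respects-letters (_≟ m) closed wm wk refl
    occ-≢1 : ∀ a → occ a w ≢ 1
    occ-≢1 false = occ₀≢1
    occ-≢1 true = occ₁≢1

module ReflectionGraph (S : List (ℕ × ℕ)) where

  infix 4 _↝_
  _↝_ : ℕ → ℕ → Set
  k ↝ k′ = ∃ λ I → I ∈ S × Active k I × reflect I k ≡ k′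

  ↝-sym : ∀ {k k′} → k ↝ k′ → k′ ↝ k
  ↝-sym {k} (I , I∈S , active , refl) =
    I , I∈S , ∈ᵢ⇒Active I (reflect-∈ᵢ I k∈I) ρρk≢ρk , reflect-involutive I k∈I
    where
    k∈I : k ∈ᵢ I
    k∈I = Active⇒∈ᵢ I active
    ρρk≢ρk : reflect I (reflect I k) ≢ reflect I k
    ρρk≢ρk ρρk≡ρk = proj₂ (proj₂ active) (trans (sym ρρk≡ρk) (reflect-involutive I k∈I))

  AtMostOneActive : ℕ → Set
  AtMostOneActive m = ∀ I J → I ∈ S → J ∈ S → Active m I → Active m J → I ≡ J

  single-neighbour : ∀ {u a b} → AtMostOneActive u → u ↝ a → u ↝ b → a ≡ b
  single-neighbour one (I , I∈S , active-I , refl) (J , J∈S , active-J , refl)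
    with one I J I∈S J∈S active-I active-J
  ... | refl = refl

  ↝⇒inRange : ∀ {n k k′} → All (InS n) S → k ↝ k′ → 1 ≤ k × k ≤ n
  ↝⇒inRange inS (I , I∈S , active , _) with All.lookup inS I∈S | Active⇒∈ᵢ I active
  ... | 1≤i , _ , j≤n | i≤k , k≤j = ≤-trans 1≤i i≤k , ≤-trans k≤j j≤n

  NoThreeNeighbours : Set
  NoThreeNeighbours = ∀ {u a b c} → u ↝ a → u ↝ b → u ↝ c → a ≢ b → a ≢ c → b ≢ c → ⊥

  module Search (x : ℕ) where

    Reach : ℕ → ℕ → Set
    Reach zero k = k ≡ x
    Reach (suc t) k = Reach t k ⊎ Any (λ I → k ∈ᵢ I × Reach t (reflect I k)) S

    reach? : ∀ t → Decidable (Reach t)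
    reach? zero k = k ≟ x
    reach? (suc t) k = reach? t k ⊎-dec any? (λ I → (k ∈ᵢ? I) ×-dec reach? t (reflect I k)) S

    reach-step : ∀ {t I k} → I ∈ S → k ∈ᵢ I → Reach t (reflect I k) → Reach (suc t) k
    reach-step I∈S k∈I reach = inj₂ (lose I∈S (k∈I , reach))

    reach-mono : ∀ {t t′ k} → t ≤ t′ → Reach t k → Reach t′ k
    reach-mono {t′ = zero} z≤n reach = reach
    reach-mono {t′ = suc t′} z≤n reach = inj₁ (reach-mono z≤n reach)
    reach-mono (s≤s t≤t′) (inj₁ reach) = inj₁ (reach-mono t≤t′ reach)
    reach-mono (s≤s t≤t′) (inj₂ step) = inj₂ (Any.map (Product.map₂ (reach-mono t≤t′)) step)

    Layer : ℕ → ℕ → Set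
    Layer zero k = k ≡ x
    Layer (suc t) k = Reach (suc t) k × ¬ Reach t k

    Layer⇒Reach : ∀ t {k} → Layer t k → Reach t k
    Layer⇒Reach zero layer = layer
    Layer⇒Reach (suc t) (reach , _) = reach

    Reach⇒Layer : ∀ t {k} → Reach t k → ∃ λ s → Layer s k
    Reach⇒Layer zero reach = zero , reach
    Reach⇒Layer (suc t) {k} reach with reach? t k
    ... | yes earlier = Reach⇒Layer t earlier
    ... | no ¬earlier = suc t , reach , ¬earlier

    layers-disjoint : ∀ {s s′ k} → s < s′ → Layer s k → ¬ Layer s′ k
    layers-disjoint {s} (s≤s s≤s″) layer (_ , ¬reach) = ¬reach (reach-mono s≤s″ (Layer⇒Reach s layer))

    parent : ∀ t {k} → Layer (suc t) k → ∃ λ p → k ↝ p × Layer t p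
    parent t (inj₁ reach , ¬reach) = ⊥-elim (¬reach reach)
    parent t {k} (inj₂ step , ¬reach) with find step
    ... | I , I∈S , k∈I , reach-ρk =
      reflect I k , (I , I∈S , ∈ᵢ⇒Active I k∈I ρk≢k , refl) , layer t reach-ρk ¬reach
      where
      ρk≢k : reflect I k ≢ k
      ρk≢k ρk≡k = ¬reach (subst (Reach t) ρk≡k reach-ρk)
      layer : ∀ t → Reach t (reflect I k) → ¬ Reach t k → Layer t (reflect I k)
      layer zero reach _ = reach
      layer (suc t) reach ¬reach′ = reach , λ earlier → ¬reach′ (reach-step I∈S k∈I earlier)

    descend : ∀ {s s′ y} → s ≤ s′ → Layer s′ y → ∃ λ z → Layer s z
    descend {s′ = zero} z≤n layer = _ , layer
    descend {s} {suc s′} s≤1+s′ layer with m≤n⇒m<n∨m≡n s≤1+s′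
    ... | inj₂ refl = _ , layer
    ... | inj₁ (s≤s s≤s′) = descend s≤s′ (proj₂ (proj₂ (parent s′ layer)))

    stable⇒closed : ∀ {t} → (∀ {k} → Reach (suc t) k → Reach t k) → ClosedUnder S (Reach t)
    stable⇒closed {t} stable {I} I∈S k∈I reach =
      stable (reach-step I∈S (reflect-∈ᵢ I k∈I) (subst (Reach t) (sym (reflect-involutive I k∈I)) reach))

    module Path (x-leaf : AtMostOneActive x) (no-three : NoThreeNeighbours) where

      two-neighbours : ∀ {u a b c} → u ↝ a → u ↝ b → u ↝ c → a ≢ c → b ≢ c → a ≡ b
      two-neighbours u↝a u↝b u↝c a≢c b≢c with _ ≟ _
      ... | yes a≡b = a≡b
      ... | no a≢b = ⊥-elim (no-three u↝a u↝b u↝c a≢b a≢c b≢c)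

      common-parent : ∀ t {p y z} → Layer t p → Layer (suc t) y → Layer (suc t) z → p ↝ y → p ↝ z → y ≡ z
      common-parent zero refl _ _ p↝y p↝z = single-neighbour x-leaf p↝y p↝z
      common-parent (suc t) p∈t+1 y∈t+2 z∈t+2 p↝y p↝z with parent t p∈t+1
      ... | g , p↝g , g∈t = two-neighbours p↝y p↝z p↝g (apart y∈t+2) (apart z∈t+2)
        where
        apart : ∀ {y} → Layer (suc (suc t)) y → y ≢ g
        apart y∈t+2 refl = layers-disjoint (<-trans (n<1+n t) (n<1+n (suc t))) g∈t y∈t+2

      layer-unique : ∀ t {y z} → Layer t y → Layer t z → y ≡ z
      layer-unique zero refl refl = refl
      layer-unique (suc t) y∈t+1 z∈t+1 with parent t y∈t+1 | parent t z∈t+1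
      ... | p , y↝p , p∈t | p′ , z↝p′ , p′∈t with layer-unique t p∈t p′∈t
      ... | refl = common-parent t p∈t y∈t+1 z∈t+1 (↝-sym y↝p) (↝-sym z↝p′)

      leaf-ends-path : ∀ s {m y s′} → AtMostOneActive m → Layer (suc s) m → Layer s′ y → suc s < s′ → ⊥
      leaf-ends-path s m-leaf m∈s+1 y∈s′ s+1<s′ with descend s+1<s′ y∈s′
      ... | z , z∈s+2 with parent (suc s) z∈s+2
      ... | p , z↝p , p∈s+1 with layer-unique (suc s) p∈s+1 m∈s+1
      ... | refl with parent s m∈s+1
      ... | g , m↝g , g∈s with single-neighbour m-leaf (↝-sym z↝p) m↝g
      ... | refl = layers-disjoint (<-trans (n<1+n s) (n<1+n (suc s))) g∈s z∈s+2

      reachable-leaves-coincide : ∀ {t t′ y z} → AtMostOneActive y → AtMostOneActive z → y ≢ x → z ≢ x →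
        Reach t y → Reach t′ z → y ≡ z
      reachable-leaves-coincide {t} {t′} y-leaf z-leaf y≢x z≢x reach-y reach-z
        with Reach⇒Layer t reach-y | Reach⇒Layer t′ reach-z
      ... | zero , y≡x | _ = ⊥-elim (y≢x y≡x)
      ... | _ | zero , z≡x = ⊥-elim (z≢x z≡x)
      ... | suc s , y∈s+1 | suc s′ , z∈s′+1 with <-cmp s s′
      ... | tri< s<s′ _ _ = ⊥-elim (leaf-ends-path s y-leaf y∈s+1 z∈s′+1 (s≤s s<s′))
      ... | tri≈ _ refl _ = layer-unique (suc s) y∈s+1 z∈s′+1
      ... | tri> _ _ s′<s = ⊥-elim (leaf-ends-path s′ z-leaf z∈s′+1 y∈s+1 (s≤s s′<s))

module _ {n : ℕ} {S : List (ℕ × ℕ)} (inS : All (InS n) S) where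

  active-at-start : Any (Active 1) S → ∃ λ p → (1 , p) ∈ S × 1 < p
  active-at-start active with find active
  ... | (i , p) , P∈S , i≤1 , 1≤p , p≢1 with ≤-antisym i≤1 (proj₁ (All.lookup inS P∈S))
  ... | refl = p , P∈S , ≤∧≢⇒< 1≤p (p≢1 ∘ sym)

  active-at-end : Any (Active n) S → ∃ λ q → (q , n) ∈ S × 1 ≤ q
  active-at-end active with find active
  ... | (q , j) , Q∈S , _ , n≤j , _ with ≤-antisym (proj₂ (proj₂ (All.lookup inS Q∈S))) n≤j
  ... | refl = q , Q∈S , proj₁ (All.lookup inS Q∈S)

-- Three neighbours of u come from three distinct intervals, which exhaust S; so u lies in the
-- palindromic prefix active at position 1 and in the palindromic suffix active at position n.
no-three-neighbours : ∀ {w : List Bool} {S} → Unbordered w → All (InS (length w)) S → All (PalFactor w) S →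
  length S ≤ 3 → Any (Active 1) S → Any (Active (length w)) S → ReflectionGraph.NoThreeNeighbours S
no-three-neighbours {w} {S} unbordered inS palindromes |S|≤3 active-1 active-n
  {u} (I , I∈S , active-I , refl) (J , J∈S , active-J , refl) (K , K∈S , active-K , refl) ρI≢ρJ ρI≢ρK ρJ≢ρK
  with active-at-start inS active-1 | active-at-end inS active-n
... | p , P∈S , 1<p | q , Q∈S , 1≤q =
  <⇒≱ (palindromic-prefix-suffix-disjoint w unbordered 1<p (proj₂ (proj₂ (All.lookup inS P∈S))) 1≤q
         (All.lookup palindromes P∈S) (All.lookup palindromes Q∈S))
      (≤-trans (proj₁ (u∈ Q∈S)) (proj₂ (u∈ P∈S)))
  where
  apart : ∀ {I J} → reflect I u ≢ reflect J u → I ≢ J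
  apart ρI≢ρJ refl = ρI≢ρJ refl
  distinct : Unique (I ∷ J ∷ K ∷ [])
  distinct = (apart ρI≢ρJ ∷ apart ρI≢ρK ∷ []) ∷ (apart ρJ≢ρK ∷ []) ∷ [] ∷ []
  IJK⊆S : I ∷ J ∷ K ∷ [] ⊆ S
  IJK⊆S (here refl) = I∈S
  IJK⊆S (there (here refl)) = J∈S
  IJK⊆S (there (there (here refl))) = K∈S
  u∈ : ∀ {L} → L ∈ S → u ∈ᵢ L
  u∈ L∈S = All.lookup (Active⇒∈ᵢ I active-I ∷ Active⇒∈ᵢ J active-J ∷ Active⇒∈ᵢ K active-K ∷ [])
             (unique-⊆-length≤⇒⊇ (≡-dec _≟_ _≟_) distinct IJK⊆S |S|≤3 L∈S)

lemma6 : (w : List Bool) (S : List (ℕ × ℕ)) →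
    Unbordered w → occ false w ≢ 1 → occ true w ≢ 1 →
    Unique S → All (InS (length w)) S → length S ≤ 3 →
    PalGen S w →
    (a : Bool) (L : List ℕ) → Unique L →
    All (λ m → IsLeaf (length w) S m × at w m ≡ just a) L →
    length L ≤ 2
lemma6 _ _ _ _ _ _ _ _ _ _ [] _ _ = z≤n
lemma6 _ _ _ _ _ _ _ _ _ _ (_ ∷ []) _ _ = s≤s z≤n
lemma6 _ _ _ _ _ _ _ _ _ _ (_ ∷ _ ∷ []) _ _ = s≤s (s≤s z≤n)
lemma6 w S unbordered occ₀≢1 occ₁≢1 _ inS |S|≤3 generates a (m₁ ∷ m₂ ∷ m₃ ∷ _)
  ((m₁≢m₂ ∷ m₁≢m₃ ∷ _) ∷ (m₂≢m₃ ∷ _) ∷ _)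
  (((1≤m₁ , m₁≤n , leaf₁) , w[m₁]) ∷ ((_ , _ , leaf₂) , w[m₂]) ∷ ((_ , _ , leaf₃) , w[m₃]) ∷ _) =
  ⊥-elim (m₂≢m₃ (reachable-leaves-coincide leaf₂ leaf₃ (m₁≢m₂ ∘ sym) (m₁≢m₃ ∘ sym)
                   (reached w[m₂]) (reached w[m₃])))
  where
  open Generation generates inS
  open ReflectionGraph S
  open Search m₁
  1≤n : 1 ≤ n
  1≤n = ≤-trans 1≤m₁ m₁≤n
  open Path leaf₁ (no-three-neighbours unbordered inS (proj₁ generates) |S|≤3
                     (every-position-active occ₀≢1 occ₁≢1 ≤-refl 1≤n)
                     (every-position-active occ₀≢1 occ₁≢1 1≤n ≤-refl))
  component : ∃ λ t → ∀ {k} → Reach (suc t) k → Reach t k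
  component = stabilises reach? n (reach-mono (n≤1+n _)) λ new ¬old →
                ↝⇒inRange inS (proj₁ (proj₂ (parent _ (new , ¬old))))
  reached : ∀ {m} → at w m ≡ just a → Reach (proj₁ component) m
  reached w[m] =
    closed-respects-letters (reach? _) (stable⇒closed (proj₂ component)) w[m₁] w[m] (reach-mono z≤n refl)
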